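{- Let $p>1$ be an integer and let $u^{(p)}$ be the fixed point of the substitution $\varphi_p(L)=L^pS$, $\varphi_p(S)=M$, $\varphi_p(M)=L^{p-1}S$ starting with $L$. Then: (i) each occurrence of $S$ in $u^{(p)}$ is preceded by $L$ and followed by either $L$ or $M$; (ii) each occurrence of $M$ in $u^{(p)}$ is preceded by $S$ and followed by $L$. -}

module Defs where

open import Data.Nat using (ℕ; zero; suc; _∸_)
open import Data.List using (List; []; _∷_; _++_; replicate; concatMap)

data Letter : Set where
  L S M : Letter

φ : ℕ → Letter → List Letter
φ p L = replicate p L ++ (S ∷ [])
φ p S = M ∷ []
φ p M = replicate (p ∸ 1) L ++ (S ∷ [])

φ* : ℕ → List Letter → List Letter
φ* p w = concatMap (φ p) w

iter : ℕ → ℕ → List Letter → List Letter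
iter q zero    w = w
iter q (suc n) w = φ* q (iter q n w)

at : Letter → List Letter → ℕ → Letter
at d []       _       = d
at d (x ∷ xs) zero    = x
at d (x ∷ xs) (suc i) = at d xs i

-- The fixed point u^(p) of φ_p starting with L, as an infinite word
-- ℕ → Letter: since φ_p(L) begins with L, each φ_p^n(L) is a prefix of
-- φ_p^(n+1)(L), and |φ_p^n(L)| ≥ n + 1, so the i-th letter of u^(p) is the
-- i-th letter of φ_p^(i+1)(L) (the default is never used).
u : ℕ → ℕ → Letter
u p i = at L (iter p (suc i) (L ∷ [])) i

-- The two-letter factors LL, LS, SL, SM, ML form a set closed under φ_p when
-- p ≥ 2: inside an image φ_p(x) ∈ {L^k S (k ≥ 1), M} only LL and LS occur, and
-- for each allowed factor xy the boundary pair (last of φ_p(x), first of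
-- φ_p(y)) is again allowed. Hence every φ_p^n(L) has only allowed factors; as
-- each φ_p^n(L) is a proper prefix of φ_p^(n+1)(L), so does u^(p), which
-- moreover starts with L. Both claims are read off the list of allowed factors.
module Submission where

open import Defs
open import Data.Nat using (ℕ; zero; suc; _>_; _<_; z≤n; s≤s)
open import Data.Nat.Properties using (≤-trans; n≤1+n; module ≤-Reasoning)
open import Data.List using (List; []; _∷_; _++_; replicate; length)
open import Data.List.Properties using (concatMap-++; length-++-sucʳ; length-++-≤ˡ)
open import Data.List.Relation.Unary.Linked using (Linked; [-]; _∷_)
open import Data.Sum using (_⊎_; inj₁; inj₂)
open import Data.Product using (_×_; ∃; ∃₂; _,_)
open import Relation.Binary.PropositionalEquality
  using (_≡_; refl; sym; trans; cong; subst; module ≡-Reasoning)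

data Adjacent : Letter → Letter → Set where
  LL : Adjacent L L
  LS : Adjacent L S
  SL : Adjacent S L
  SM : Adjacent S M
  ML : Adjacent M L

L-before-S : ∀ {a} → Adjacent a S → a ≡ L
L-before-S LS = refl

L-or-M-after-S : ∀ {b} → Adjacent S b → b ≡ L ⊎ b ≡ M
L-or-M-after-S SL = inj₁ refl
L-or-M-after-S SM = inj₂ refl

S-before-M : ∀ {a} → Adjacent a M → a ≡ S
S-before-M SM = refl

L-after-M : ∀ {b} → Adjacent M b → b ≡ L
L-after-M ML = refl

module _ {s : ℕ → Letter} (s₀≡L : s 0 ≡ L)
         (adjacent : ∀ i → Adjacent (s i) (s (suc i))) where

  S-neighbours : ∀ i → s i ≡ S →
    ∃ (λ j → i ≡ suc j × s j ≡ L) × (s (suc i) ≡ L ⊎ s (suc i) ≡ M)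
  S-neighbours zero    s₀≡S with () ← trans (sym s₀≡L) s₀≡S
  S-neighbours (suc j) sᵢ≡S =
    (j , refl , L-before-S (subst (Adjacent (s j)) sᵢ≡S (adjacent j))) ,
    L-or-M-after-S (subst (λ a → Adjacent a (s (suc (suc j)))) sᵢ≡S (adjacent (suc j)))

  M-neighbours : ∀ i → s i ≡ M →
    ∃ (λ j → i ≡ suc j × s j ≡ S) × s (suc i) ≡ L
  M-neighbours zero    s₀≡M with () ← trans (sym s₀≡L) s₀≡M
  M-neighbours (suc j) sᵢ≡M =
    (j , refl , S-before-M (subst (Adjacent (s j)) sᵢ≡M (adjacent j))) ,
    L-after-M (subst (λ a → Adjacent a (s (suc (suc j)))) sᵢ≡M (adjacent (suc j)))

at-++ˡ : ∀ {d} xs {ys i} → i < length xs → at d (xs ++ ys) i ≡ at d xs i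
at-++ˡ (x ∷ xs) {i = zero}  _           = refl
at-++ˡ (x ∷ xs) {i = suc i} (s≤s i<xs) = at-++ˡ xs i<xs

at-Linked : ∀ {R : Letter → Letter → Set} {d xs} i → Linked R xs →
            suc i < length xs → R (at d xs i) (at d xs (suc i))
at-Linked i       [-]       (s≤s ())
at-Linked zero    (Rxy ∷ _) _          = Rxy
at-Linked (suc i) (_ ∷ Rxs) (s≤s i<xs) = at-Linked i Rxs i<xs

-- First and last letter of φ_p(x); φ-head M is only right for p ≥ 2, as φ_1(M) = S.
φ-head : Letter → Letter
φ-head L = L
φ-head S = M
φ-head M = L

φ-last : Letter → Letter
φ-last L = S
φ-last S = M
φ-last M = S

Adjacent-φ-boundary : ∀ {x y} → Adjacent x y → Adjacent (φ-last x) (φ-head y)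
Adjacent-φ-boundary LL = SL
Adjacent-φ-boundary LS = SM
Adjacent-φ-boundary SL = ML
Adjacent-φ-boundary SM = ML
Adjacent-φ-boundary ML = SL

Lⁿ⁺¹S-linked : ∀ n {a rest} → Adjacent a L → Linked Adjacent (S ∷ rest) →
               Linked Adjacent (a ∷ (replicate (suc n) L ++ S ∷ []) ++ rest)
Lⁿ⁺¹S-linked zero    aL Srest = aL ∷ LS ∷ Srest
Lⁿ⁺¹S-linked (suc n) aL Srest = aL ∷ Lⁿ⁺¹S-linked n LL Srest

module Iterates (q : ℕ) where

  p : ℕ
  p = suc (suc q)

  φ-linked : ∀ y {a rest} → Adjacent a (φ-head y) →
             Linked Adjacent (φ-last y ∷ rest) → Linked Adjacent (a ∷ φ p y ++ rest)
  φ-linked L aL Srest = Lⁿ⁺¹S-linked (suc q) aL Srest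
  φ-linked S aM Mrest = aM ∷ Mrest
  φ-linked M aL Srest = Lⁿ⁺¹S-linked q aL Srest

  φ*-linked : ∀ {x} w → Linked Adjacent (x ∷ w) → Linked Adjacent (φ-last x ∷ φ* p w)
  φ*-linked []       _          = [-]
  φ*-linked (y ∷ ys) (xy ∷ yys) = φ-linked y (Adjacent-φ-boundary xy) (φ*-linked ys yys)

  φ-++-nonempty : ∀ y r → ∃₂ λ z r′ → φ p y ++ r ≡ z ∷ r′
  φ-++-nonempty L r = _ , _ , refl
  φ-++-nonempty S r = _ , _ , refl
  φ-++-nonempty M r = _ , _ , refl

  W : ℕ → List Letter
  W n = iter p n (L ∷ [])

  W-linked : ∀ n → ∃ λ t → W n ≡ L ∷ t × Linked Adjacent (L ∷ t)
  W-linked zero = [] , refl , [-]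
  W-linked (suc n) with W n | W-linked n
  ... | .(L ∷ t) | t , refl , Lt = _ , refl , Lⁿ⁺¹S-linked q LL (φ*-linked t Lt)

  W-proper-prefix : ∀ n → ∃₂ λ x r → W (suc n) ≡ W n ++ x ∷ r
  W-proper-prefix zero = _ , _ , refl
  W-proper-prefix (suc n) with W-proper-prefix n
  ... | x , r , extends with φ-++-nonempty x (φ* p r)
  ... | z , r′ , nonempty = z , r′ , (begin
    φ* p (W (suc n))             ≡⟨ cong (φ* p) extends ⟩
    φ* p (W n ++ x ∷ r)          ≡⟨ concatMap-++ (φ p) (W n) (x ∷ r) ⟩
    W (suc n) ++ φ p x ++ φ* p r ≡⟨ cong (W (suc n) ++_) nonempty ⟩
    W (suc n) ++ z ∷ r′          ∎)
    where open ≡-Reasoning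

  W-length : ∀ n → n < length (W n)
  W-length zero = s≤s z≤n
  W-length (suc n) with W-proper-prefix n
  ... | x , r , extends = begin
    suc (suc n)               ≤⟨ s≤s (W-length n) ⟩
    suc (length (W n))        ≤⟨ s≤s (length-++-≤ˡ (W n)) ⟩
    suc (length (W n ++ r))   ≡⟨ sym (length-++-sucʳ (W n) x r) ⟩
    length (W n ++ x ∷ r)     ≡⟨ cong length (sym extends) ⟩
    length (W (suc n))        ∎
    where open ≤-Reasoning

  W-stable : ∀ n {i} → i < length (W n) → at L (W (suc n)) i ≡ at L (W n) i
  W-stable n i<Wn with W-proper-prefix n
  ... | x , r , extends = trans (cong (λ w → at L w _) extends) (at-++ˡ (W n) i<Wn)

  W-adjacent : ∀ n i → suc i < length (W n) →
               Adjacent (at L (W n) i) (at L (W n) (suc i))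
  W-adjacent n i with W n | W-linked n
  ... | .(L ∷ t) | t , refl , Lt = at-Linked i Lt

  u-head : u p 0 ≡ L
  u-head = refl

  u-adjacent : ∀ i → Adjacent (u p i) (u p (suc i))
  u-adjacent i =
    subst (λ a → Adjacent a (u p (suc i)))
          (W-stable (suc i) (≤-trans (n≤1+n (suc i)) (W-length (suc i))))
          (W-adjacent (suc (suc i)) i (≤-trans (n≤1+n _) (W-length (suc (suc i)))))

mainTheorem7 : (p : ℕ) → p > 1 →
    (∀ i → u p i ≡ S →
      ∃ (λ j → i ≡ suc j × u p j ≡ L) × (u p (suc i) ≡ L ⊎ u p (suc i) ≡ M))
    × (∀ i → u p i ≡ M →
      ∃ (λ j → i ≡ suc j × u p j ≡ S) × u p (suc i) ≡ L)
mainTheorem7 (suc (suc q)) (s≤s (s≤s z≤n)) =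
  S-neighbours u-head u-adjacent , M-neighbours u-head u-adjacent
  where open Iterates q
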